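{- For every integer $k\ge 5$, $P_k\not\le C_{k-2}$.
   Context: All graphs are finite and simple, considered up to isomorphism. An edge-colored graph is a pair $(G,c)$ with $c\colon E(G)\to\mathbb{N}$ an arbitrary map (not necessarily proper); it is colored in $t$ or more colors if $|c(E(G))|\ge t$. A subgraph (not necessarily induced) is rainbow if its edges receive pairwise distinct colors. $(G,c)$ is rainbow $H$-free if $G$ contains no rainbow subgraph isomorphic to $H$. For graphs $H_1,H_2$, write $H_1\le H_2$ if there is a positive integer $t$ such that every rainbow $H_1$-free edge-colored complete graph colored in $t$ or more colors is rainbow $H_2$-free. $P_k$ and $C_k$ are the path and the cycle on $k$ vertices. -}

module Defs where

open import Data.Nat using (ℕ; zero; suc; _≡ᵇ_; _≤_; _∸_)
open import Data.Fin using (Fin; toℕ)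
open import Data.Product using (Σ; _×_; _,_; ∃; ∃-syntax)
open import Data.Sum using (_⊎_)
open import Relation.Binary.PropositionalEquality using (_≡_; _≢_)
open import Relation.Nullary using (¬_)
open import Function.Definitions using (Injective)

record Graph : Set₁ where
  field
    order : ℕ
    Adj   : Fin order → Fin order → Set
    adjSym : ∀ {i j} → Adj i j → Adj j i
    adjIrr : ∀ {i} → ¬ Adj i i
open Graph public

-- An edge-coloring of the complete graph K_n on Fin n: a symmetric map
-- assigning a colour to each unordered pair {u,v}, u ≠ v (values on the
-- diagonal are irrelevant and never used).
record EdgeColoring (n : ℕ) : Set where
  field
    col    : Fin n → Fin n → ℕ
    colSym : ∀ u v → col u v ≡ col v u
open EdgeColoring public

-- (K_n , c) is colored in t or more colors: there are t edges of K_n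
-- whose colours are pairwise distinct, i.e. |c(E(K_n))| ≥ t.
AtLeastColors : ∀ {n} → EdgeColoring n → ℕ → Set
AtLeastColors {n} c t =
  Σ (Fin t → Fin n × Fin n) λ e →
    (∀ i → let (u , v) = e i in u ≢ v) ×
    (∀ i j → (let (u , v) = e i in col c u v) ≡ (let (u' , v') = e j in col c u' v') → i ≡ j)

RainbowCopy : (H : Graph) → ∀ {n} → EdgeColoring n → Set
RainbowCopy H {n} c =
  Σ (Fin (order H) → Fin n) λ φ →
    Injective _≡_ _≡_ φ ×
    (∀ i j i' j' → Adj H i j → Adj H i' j' →
       col c (φ i) (φ j) ≡ col c (φ i') (φ j') →
       (i ≡ i' × j ≡ j') ⊎ (i ≡ j' × j ≡ i'))

RainbowFree : (H : Graph) → ∀ {n} → EdgeColoring n → Set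
RainbowFree H c = ¬ RainbowCopy H c

_≼_ : Graph → Graph → Set
H₁ ≼ H₂ = ∃[ t ] (1 ≤ t × (∀ n (c : EdgeColoring n) →
             AtLeastColors c t → RainbowFree H₁ c → RainbowFree H₂ c))

Consec : ∀ {m} → Fin m → Fin m → Set
Consec i j = suc (toℕ i) ≡ toℕ j

Wrap : ∀ {m} → Fin m → Fin m → Set
Wrap {m} i j = toℕ i ≡ 0 × suc (toℕ j) ≡ m × 3 ≤ m

private
  open import Relation.Binary.PropositionalEquality using (refl; trans; sym)
  open import Data.Sum using (inj₁; inj₂)
  open import Data.Nat.Properties using (<-irrefl; ≤-refl)
  import Data.Nat as N

  consecIrr : ∀ {m} {i : Fin m} → ¬ Consec i i
  consecIrr {i = i} e = <-irrefl (sym e) (N.s≤s ≤-refl)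

  wrapIrr : ∀ {m} {i : Fin m} → ¬ Wrap i i
  wrapIrr {i = i} (e0 , e1 , N.s≤s (N.s≤s (N.s≤s _))) with toℕ i
  wrapIrr (refl , () , N.s≤s (N.s≤s (N.s≤s _))) | .0

Path : ℕ → Graph
Path m = record
  { order = m
  ; Adj   = λ i j → Consec i j ⊎ Consec j i
  ; adjSym = λ { (inj₁ p) → inj₂ p ; (inj₂ p) → inj₁ p }
  ; adjIrr = λ { (inj₁ p) → consecIrr p ; (inj₂ p) → consecIrr p }
  }

Cycle : ℕ → Graph
Cycle m = record
  { order = m
  ; Adj   = λ i j → (Consec i j ⊎ Consec j i) ⊎ (Wrap i j ⊎ Wrap j i)
  ; adjSym = λ { (inj₁ (inj₁ p)) → inj₁ (inj₂ p) ; (inj₁ (inj₂ p)) → inj₁ (inj₁ p)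
              ; (inj₂ (inj₁ p)) → inj₂ (inj₂ p) ; (inj₂ (inj₂ p)) → inj₂ (inj₁ p) }
  ; adjIrr = λ { (inj₁ (inj₁ p)) → consecIrr p ; (inj₁ (inj₂ p)) → consecIrr p
              ; (inj₂ (inj₁ p)) → wrapIrr p ; (inj₂ (inj₂ p)) → wrapIrr p }
  }

{-# OPTIONS --safe #-}
-- Write k = m + 5. Colour K_n so that the edges at vertex 0 form a rainbow star in colours
-- above m and every other edge {a + 1, b + 1} gets colour min(a, b, m). For n large this uses
-- any number of colours, and the cycle 0, 1, …, m + 2 is rainbow. But only m + 1 colours
-- avoid vertex 0 and a path has at most two edges at vertex 0 (one entering it, one leaving
-- it), so a rainbow path has at most m + 3 edges and there is no rainbow P_{m+5}.
module Submission where

open import Defs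
open import Data.Nat using (ℕ; _≤_; _∸_)
open import Relation.Nullary using (¬_)

open import Data.Nat using (zero; suc; _+_; _⊓_; _<_; _≤?_; s≤s; z≤n)
import Data.Nat.Properties as ℕ
open import Data.Fin using (Fin; zero; suc; toℕ; fromℕ<; inject₁; inject≤)
open import Data.Fin.Properties
  using (toℕ-injective; toℕ<n; toℕ-inject₁; toℕ-inject≤; toℕ-fromℕ<; inject₁-injective; inject≤-injective; injective⇒≤)
  renaming (suc-injective to Fin-suc-injective)
open import Data.Product using (_×_; _,_; proj₁)
open import Data.Sum using (_⊎_; inj₁; inj₂; map; map₁; map₂)
open import Function using (_∘_)
open import Function.Definitions using (Injective)
open import Relation.Nullary using (yes; no; contradiction)
open import Relation.Binary.PropositionalEquality

SameEdge : ℕ × ℕ → ℕ × ℕ → Set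
SameEdge (a , b) (a' , b') = (a ≡ a' × b ≡ b') ⊎ (a ≡ b' × b ≡ a')

SameEdge-trans : ∀ {x y z} → SameEdge y x → SameEdge y z → SameEdge x z
SameEdge-trans (inj₁ (refl , refl)) (inj₁ (refl , refl)) = inj₁ (refl , refl)
SameEdge-trans (inj₁ (refl , refl)) (inj₂ (refl , refl)) = inj₂ (refl , refl)
SameEdge-trans (inj₂ (refl , refl)) (inj₁ (refl , refl)) = inj₂ (refl , refl)
SameEdge-trans (inj₂ (refl , refl)) (inj₂ (refl , refl)) = inj₁ (refl , refl)

≡⇒SameEdge : ∀ {x a b} → x ≡ (a , b) → SameEdge x (a , b)
≡⇒SameEdge refl = inj₁ (refl , refl)

≡-swap⇒SameEdge : ∀ {x a b} → x ≡ (b , a) → SameEdge x (a , b)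
≡-swap⇒SameEdge refl = inj₂ (refl , refl)

consec-inject₁-suc : ∀ {L} (i : Fin L) → Consec (inject₁ i) (suc i)
consec-inject₁-suc i = cong suc (toℕ-inject₁ i)

pathEdgeColour : ∀ {L n} {c : EdgeColoring n} → RainbowCopy (Path (suc L)) c → Fin L → ℕ
pathEdgeColour {c = c} (φ , _) i = col c (φ (inject₁ i)) (φ (suc i))

pathEdgeColour-injective : ∀ {L n} {c : EdgeColoring n} (copy : RainbowCopy (Path (suc L)) c) →
                           Injective _≡_ _≡_ (pathEdgeColour {c = c} copy)
pathEdgeColour-injective (φ , _ , rainbow) {i} {j} eq
  with rainbow (inject₁ i) (suc i) (inject₁ j) (suc j) (inj₁ (consec-inject₁-suc i)) (inj₁ (consec-inject₁-suc j)) eq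
... | inj₁ (i≡j , _) = inject₁-injective i≡j
... | inj₂ (i≡1+j , 1+i≡j) = contradiction i<j (ℕ.<⇒≯ j<i)
  where
  i<j : toℕ i < toℕ j
  i<j = ℕ.≤-reflexive (trans (cong toℕ 1+i≡j) (toℕ-inject₁ j))
  j<i : toℕ j < toℕ i
  j<i = ℕ.≤-reflexive (trans (sym (cong toℕ i≡1+j)) (toℕ-inject₁ i))

-- The edges of a rainbow path have distinct first endpoints, distinct second endpoints and
-- distinct colours, so the path meets each class at most once.
rainbowPath-length-≤ : ∀ {L n p} {c : EdgeColoring n} (class : Fin n → Fin n → Fin p) →
                       (∀ u v u' v' → class u v ≡ class u' v' → u ≡ u' ⊎ v ≡ v' ⊎ col c u v ≡ col c u' v') →
                       RainbowCopy (Path (suc L)) c → L ≤ p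
rainbowPath-length-≤ {c = c} class class-determines copy@(φ , φ-injective , _) = injective⇒≤ edgeClass-injective
  where
  edgeClass-injective : Injective _≡_ _≡_ (λ i → class (φ (inject₁ i)) (φ (suc i)))
  edgeClass-injective eq with class-determines _ _ _ _ eq
  ... | inj₁ e = inject₁-injective (φ-injective e)
  ... | inj₂ (inj₁ e) = Fin-suc-injective (φ-injective e)
  ... | inj₂ (inj₂ e) = pathEdgeColour-injective {c = c} copy e

rainbowCopy-byDecoding : ∀ (H : Graph) {n} (c : EdgeColoring n) (φ : Fin (order H) → Fin n) →
                         Injective _≡_ _≡_ φ → (decode : ℕ → ℕ × ℕ) →
                         (∀ i j → Adj H i j → SameEdge (decode (col c (φ i) (φ j))) (toℕ i , toℕ j)) →
                         RainbowCopy H c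
rainbowCopy-byDecoding H c φ φ-injective decode decodes = φ , φ-injective , rainbow
  where
  rainbow : ∀ i j i' j' → Adj H i j → Adj H i' j' → col c (φ i) (φ j) ≡ col c (φ i') (φ j') →
            (i ≡ i' × j ≡ j') ⊎ (i ≡ j' × j ≡ i')
  rainbow i j i' j' ij i'j' eq
    with SameEdge-trans (decodes i j ij) (subst (λ x → SameEdge (decode x) _) (sym eq) (decodes i' j' i'j'))
  ... | inj₁ (e , e') = inj₁ (toℕ-injective e , toℕ-injective e')
  ... | inj₂ (e , e') = inj₂ (toℕ-injective e , toℕ-injective e')

atLeastColors-star : ∀ {N t} (c : EdgeColoring (suc N)) → Injective _≡_ _≡_ (col c zero ∘ suc) →
                     t ≤ N → AtLeastColors c t
atLeastColors-star c star-injective t≤N =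
  (λ i → zero , suc (inject≤ i t≤N)) , (λ _ ()) , λ i j → inject≤-injective t≤N t≤N i j ∘ star-injective

colour : ℕ → ℕ → ℕ → ℕ
colour m zero    b       = suc m + b
colour m (suc a) zero    = suc m + suc a
colour m (suc a) (suc b) = a ⊓ b ⊓ m

colour-sym : ∀ m a b → colour m a b ≡ colour m b a
colour-sym m zero    zero    = refl
colour-sym m zero    (suc b) = refl
colour-sym m (suc a) zero    = refl
colour-sym m (suc a) (suc b) = cong (_⊓ m) (ℕ.⊓-comm a b)

coloring : ∀ m n → EdgeColoring n
coloring m n = record
  { col    = λ u v → colour m (toℕ u) (toℕ v)
  ; colSym = λ u v → colour-sym m (toℕ u) (toℕ v)
  }

coloring-star-injective : ∀ m {N} → Injective _≡_ _≡_ (col (coloring m (suc N)) zero ∘ suc)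
coloring-star-injective m = toℕ-injective ∘ ℕ.suc-injective ∘ ℕ.+-cancelˡ-≡ (suc m) _ _

edgeClass : ∀ m → ℕ → ℕ → Fin (3 + m)
edgeClass m zero    b       = zero
edgeClass m (suc a) zero    = suc zero
edgeClass m (suc a) (suc b) = suc (suc (fromℕ< (s≤s (ℕ.m⊓n≤n (a ⊓ b) m))))

edgeClass-determines : ∀ m a b a' b' → edgeClass m a b ≡ edgeClass m a' b' →
                       a ≡ a' ⊎ b ≡ b' ⊎ colour m a b ≡ colour m a' b'
edgeClass-determines m zero    b       zero     b'       _  = inj₁ refl
edgeClass-determines m (suc a) zero    (suc a') zero     _  = inj₂ (inj₁ refl)
edgeClass-determines m (suc a) (suc b) (suc a') (suc b') eq = inj₂ (inj₂ (begin
  a ⊓ b ⊓ m      ≡⟨ toℕ-fromℕ< _ ⟨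
  toℕ low        ≡⟨ cong toℕ (Fin-suc-injective (Fin-suc-injective eq)) ⟩
  toℕ low'       ≡⟨ toℕ-fromℕ< _ ⟩
  a' ⊓ b' ⊓ m    ∎))
  where
  open ≡-Reasoning
  low  = fromℕ< (s≤s (ℕ.m⊓n≤n (a ⊓ b) m))
  low' = fromℕ< (s≤s (ℕ.m⊓n≤n (a' ⊓ b') m))
edgeClass-determines m zero    b       (suc a') zero     ()
edgeClass-determines m zero    b       (suc a') (suc b') ()
edgeClass-determines m (suc a) zero    zero     b'       ()
edgeClass-determines m (suc a) zero    (suc a') (suc b') ()
edgeClass-determines m (suc a) (suc b) zero     b'       ()
edgeClass-determines m (suc a) (suc b) (suc a') zero     ()

coloring-rainbowPathFree : ∀ m n → RainbowFree (Path (5 + m)) (coloring m n)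
coloring-rainbowPathFree m n copy = ℕ.1+n≰n (rainbowPath-length-≤ {c = coloring m n} class class-determines copy)
  where
  class : Fin n → Fin n → Fin (3 + m)
  class u v = edgeClass m (toℕ u) (toℕ v)
  class-determines : ∀ u v u' v' → class u v ≡ class u' v' →
                     u ≡ u' ⊎ v ≡ v' ⊎ col (coloring m n) u v ≡ col (coloring m n) u' v'
  class-determines u v u' v' = map toℕ-injective (map₁ toℕ-injective) ∘ edgeClass-determines m _ _ _ _

-- Colour x ≤ m lies on the cycle edge {x + 1, x + 2}, colour m + 1 + b on the star edge {0, b}.
decodeColour : ℕ → ℕ → ℕ × ℕ
decodeColour m x with x ≤? m
... | yes _ = suc x , suc (suc x)
... | no  _ = zero , x ∸ suc m

decodeColour-low : ∀ m x → x ≤ m → decodeColour m x ≡ (suc x , suc (suc x))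
decodeColour-low m x x≤m with x ≤? m
... | yes _   = refl
... | no  x≰m = contradiction x≤m x≰m

decodeColour-star : ∀ m b → decodeColour m (suc m + b) ≡ (zero , b)
decodeColour-star m b with suc m + b ≤? m
... | yes m+b<m = contradiction m+b<m (ℕ.m+n≮m m b)
... | no  _     = cong (zero ,_) (ℕ.m+n∸m≡n (suc m) b)

colour-consecutive : ∀ m a → a ≤ m → colour m (suc a) (suc (suc a)) ≡ a
colour-consecutive m a a≤m = begin
  a ⊓ suc a ⊓ m  ≡⟨ cong (_⊓ m) (ℕ.m≤n⇒m⊓n≡m (ℕ.n≤1+n a)) ⟩
  a ⊓ m          ≡⟨ ℕ.m≤n⇒m⊓n≡m a≤m ⟩
  a              ∎
  where open ≡-Reasoning

decodeColour-cycleEdge : ∀ m a b → b ≤ 2 + m → suc a ≡ b ⊎ a ≡ 0 → decodeColour m (colour m a b) ≡ (a , b)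
decodeColour-cycleEdge m zero    b _ _ = decodeColour-star m b
decodeColour-cycleEdge m (suc a) _ (s≤s (s≤s a≤m)) (inj₁ refl) =
  trans (cong (decodeColour m) (colour-consecutive m a a≤m)) (decodeColour-low m a a≤m)

coloring-rainbowCycle : ∀ m {n} → 3 + m ≤ n → RainbowCopy (Cycle (3 + m)) (coloring m n)
coloring-rainbowCycle m {n} K≤n =
  rainbowCopy-byDecoding (Cycle (3 + m)) (coloring m n) φ (inject≤-injective _ _ _ _) (decodeColour m) decodes
  where
  φ : Fin (3 + m) → Fin n
  φ i = inject≤ i K≤n
  decode : Fin (3 + m) → Fin (3 + m) → ℕ × ℕ
  decode i j = decodeColour m (col (coloring m n) (φ i) (φ j))
  decode-oriented : ∀ i j → Consec i j ⊎ Wrap i j → decode i j ≡ (toℕ i , toℕ j)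
  decode-oriented i j edge = begin
    decodeColour m (colour m (toℕ (φ i)) (toℕ (φ j)))
      ≡⟨ cong₂ (λ a b → decodeColour m (colour m a b)) (toℕ-inject≤ i K≤n) (toℕ-inject≤ j K≤n) ⟩
    decodeColour m (colour m (toℕ i) (toℕ j))
      ≡⟨ decodeColour-cycleEdge m (toℕ i) (toℕ j) (ℕ.≤-pred (toℕ<n j)) (map₂ proj₁ edge) ⟩
    (toℕ i , toℕ j)
      ∎
    where open ≡-Reasoning
  decode-sym : ∀ i j → decode i j ≡ decode j i
  decode-sym i j = cong (decodeColour m) (colSym (coloring m n) (φ i) (φ j))
  decodes : ∀ i j → Adj (Cycle (3 + m)) i j → SameEdge (decode i j) (toℕ i , toℕ j)
  decodes i j (inj₁ (inj₁ ij)) = ≡⇒SameEdge (decode-oriented i j (inj₁ ij))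
  decodes i j (inj₁ (inj₂ ji)) = ≡-swap⇒SameEdge (trans (decode-sym i j) (decode-oriented j i (inj₁ ji)))
  decodes i j (inj₂ (inj₁ ij)) = ≡⇒SameEdge (decode-oriented i j (inj₂ ij))
  decodes i j (inj₂ (inj₂ ji)) = ≡-swap⇒SameEdge (trans (decode-sym i j) (decode-oriented j i (inj₂ ji)))

theorem9 : ∀ (k : ℕ) → 5 ≤ k → ¬ (Path k ≼ Cycle (k ∸ 2))
theorem9 _ (s≤s (s≤s (s≤s (s≤s (s≤s {n = m} z≤n))))) (t , _ , rainbowPathFree⇒rainbowCycleFree) =
  rainbowPathFree⇒rainbowCycleFree n (coloring m n) manyColours (coloring-rainbowPathFree m n) rainbowCycle
  where
  n : ℕ
  n = 3 + m + t
  manyColours : AtLeastColors (coloring m n) t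
  manyColours = atLeastColors-star (coloring m n) (coloring-star-injective m) (ℕ.m≤n+m t (2 + m))
  rainbowCycle : RainbowCopy (Cycle (3 + m)) (coloring m n)
  rainbowCycle = coloring-rainbowCycle m (ℕ.m≤m+n (3 + m) t)
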